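{- Let $t,c\in\mathbb{N}$ and $\lambda>1+\frac3t$. Let $G$ be a graph with $\overline{\mathsf d}(G)\geq t$ such that $\overline{\mathsf d}(H)\le t$ for every proper subgraph $H$ of $G$ with at least one vertex. Suppose $\emptyset\ne X\subsetneq V(G)$ satisfies $\delta(G[X])\geq\frac t2$ and $\deg_G(u)>\lambda t-1$ for every $u\in V(G)\setminus X$. Then $G$ contains a subgraph on $t$ vertices with at least $\frac{(\lambda-1-\frac3t)t}{(\lambda-\frac34)|X|}\binom{t}{2}$ edges.
   Context: All graphs are finite and simple. The average degree of a graph $G$ is $\overline{\mathsf d}(G)=\frac{\sum_{u\in V(G)}\deg_G(u)}{|V(G)|}$. $G[X]$ is the subgraph induced by $X$, and $\delta(H)$ is the minimum degree of $H$. (The parameter $c$ plays no role in the statement.)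
   Formalization: The parameter λ ranges over the rationals. -}

module Defs where

open import Data.Bool using (Bool; true; false; if_then_else_; _∧_)
open import Data.Nat as ℕ using (ℕ; zero; suc)
open import Data.Fin using (Fin; toℕ)
import Data.Fin as F
open import Data.Integer using (+_)
open import Data.Rational using (ℚ; 0ℚ; _/_; _÷_; ≢-nonZero)
open import Data.Rational.Properties using (_≟_)
open import Data.Product using (_×_)
open import Relation.Binary.PropositionalEquality using (_≡_)
open import Relation.Nullary using (¬_; yes; no)

count : ∀ {n} → (Fin n → Bool) → ℕ
count {zero} p = 0
count {suc n} p = (if p F.zero then 1 else 0) ℕ.+ count (λ i → p (F.suc i))

sumF : ∀ {n} → (Fin n → ℕ) → ℕ
sumF {zero} f = 0
sumF {suc n} f = f F.zero ℕ.+ sumF (λ i → f (F.suc i))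

ℕ→ℚ : ℕ → ℚ
ℕ→ℚ n = + n / 1

-- total division on ℚ (x / 0 := 0); only ever used with nonzero denominators
divQ : ℚ → ℚ → ℚ
divQ p q with q ≟ 0ℚ
... | yes _ = 0ℚ
... | no q≢0 = _÷_ p q {{≢-nonZero q≢0}}

record Graph (n : ℕ) : Set where
  field
    adj    : Fin n → Fin n → Bool
    sym    : ∀ u v → adj u v ≡ adj v u
    irrefl : ∀ u → adj u u ≡ false
open Graph public

deg : ∀ {n} → Graph n → Fin n → ℕ
deg G u = count (adj G u)

numEdges : ∀ {n} → Graph n → ℕ
numEdges G = sumF (λ u → count (λ v → (toℕ u ℕ.<ᵇ toℕ v) ∧ adj G u v))

-- average degree of G (0 for the empty graph, where it is undefined)
avgDeg : ∀ {n} → Graph n → ℚ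
avgDeg {n} G = divQ (ℕ→ℚ (sumF (deg G))) (ℕ→ℚ n)

record Subgraph {n : ℕ} (G : Graph n) : Set where
  field
    vert     : Fin n → Bool
    edge     : Fin n → Fin n → Bool
    edge-sym : ∀ u v → edge u v ≡ edge v u
    edge-sub : ∀ u v → edge u v ≡ true → adj G u v ≡ true
    edge-end : ∀ u v → edge u v ≡ true → vert u ≡ true
open Subgraph public

module _ {n : ℕ} {G : Graph n} where
  numVert : Subgraph G → ℕ
  numVert H = count (vert H)

  degSub : Subgraph G → Fin n → ℕ
  degSub H u = count (edge H u)

  numEdgesSub : Subgraph G → ℕ
  numEdgesSub H = sumF (λ u → count (λ v → (toℕ u ℕ.<ᵇ toℕ v) ∧ edge H u v))

  avgDegSub : Subgraph G → ℚ
  avgDegSub H = divQ (ℕ→ℚ (sumF (λ u → if vert H u then degSub H u else 0))) (ℕ→ℚ (numVert H))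

  Proper : Subgraph G → Set
  Proper H = ¬ ((∀ u → vert H u ≡ true) × (∀ u v → edge H u v ≡ adj G u v))

degInduced : ∀ {n} → Graph n → (Fin n → Bool) → Fin n → ℕ
degInduced G X u = count (λ v → X v ∧ adj G u v)

-- Write Y = V ∖ X, x = |X|, y = |Y| and n = x + y. As every proper subgraph has average degree at
-- most t, deleting one edge gives 2e(G) ≤ tn + 2 and deleting X gives 2e(G[Y]) ≤ ty, while
-- δ(G[X]) ≥ t/2 gives 2e(G[X]) ≥ tx. Splitting the degree sum along the cut (X, Y) then yields
-- 4 Σ_{u∈Y} deg u ≤ tx + 4ty + 4, and comparing with Σ_{u∈Y} deg u > y(λt − 1) gives
-- (λt − t − 3)(n − 1) ≤ t(λ − 3/4)x. On the other hand, deleting a vertex of below-average degree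
-- never lowers the edge density e/C(k,2), so deleting such vertices one at a time down to t of them
-- leaves a t-set T with e(G[T]) ≥ C(t,2)·e(G)/C(n,2) ≥ t·C(t,2)/(n − 1).
module Submission where

open import Defs hiding (sym)
open import Data.Bool using (Bool; true; false; if_then_else_; _∧_; _∨_; not)
open import Data.Bool.Properties using (∧-zeroʳ; not-injective)
open import Data.Nat as ℕ using (ℕ; zero; suc; pred; z≤n; s≤s; _≥_)
import Data.Nat.Properties as ℕ
open import Data.Nat.Combinatorics using (_C_)
open import Data.Fin as F using (Fin)
import Data.Fin.Properties as F
open import Data.Product using (Σ; ∃; _×_; _,_; proj₁; proj₂)
open import Relation.Binary.PropositionalEquality
open import Relation.Nullary using (yes; no; does; contradiction)
open import Function using (_∘_)

module Counting where
  open import Data.Nat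
  open import Data.Nat.Properties
  open import Data.Nat.Combinatorics using (nCk+nC[k+1]≡[n+1]C[k+1]; nC1≡n)
  open import Data.Nat.Solver using (module +-*-Solver)
  open import Data.Bool.Properties using () renaming (_≟_ to _≟ᵇ_)
  open import Relation.Nullary.Decidable using (dec-true; dec-false; _×-dec_)

  𝟙 : Bool → ℕ
  𝟙 true  = 1
  𝟙 false = 0

  ∧-exchange : ∀ s t {a b} → a ≡ b → s ∧ t ∧ a ≡ t ∧ s ∧ b
  ∧-exchange true  true  a≡b = a≡b
  ∧-exchange true  false _   = refl
  ∧-exchange false true  _   = refl
  ∧-exchange false false _   = refl

  ∧-true⇒ˡ : ∀ x {y} → x ∧ y ≡ true → x ≡ true
  ∧-true⇒ˡ true _ = refl

  ∧-true⇒ʳ : ∀ x {y} → x ∧ y ≡ true → y ≡ true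
  ∧-true⇒ʳ true y≡true = y≡true

  𝟙-∨ : ∀ x y → 𝟙 (x ∨ y) ≤ 𝟙 x + 𝟙 y
  𝟙-∨ true  y = s≤s z≤n
  𝟙-∨ false y = ≤-refl

  𝟙-∧-not : ∀ r p → 𝟙 r ≤ 𝟙 (r ∧ not p) + 𝟙 p
  𝟙-∧-not true  true  = s≤s z≤n
  𝟙-∧-not true  false = s≤s z≤n
  𝟙-∧-not false p     = z≤n

  𝟙-split : ∀ s x r → 𝟙 (s ∧ r) ≡ 𝟙 ((s ∧ x) ∧ r) + 𝟙 ((s ∧ not x) ∧ r)
  𝟙-split false x     r = refl
  𝟙-split true  true  r = sym (+-identityʳ _)
  𝟙-split true  false r = refl

  Subset : ℕ → Set
  Subset n = Fin n → Bool

  module _ {n : ℕ} where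
    ⊤ₛ : Subset n
    ⊤ₛ _ = true

    _∩_ : Subset n → Subset n → Subset n
    (S ∩ X) i = S i ∧ X i

    ∁ : Subset n → Subset n
    ∁ X i = not (X i)

    ｛_｝ : Fin n → Subset n
    ｛ a ｝ i = does (i F.≟ a)

    sumOver : Subset n → (Fin n → ℕ) → ℕ
    sumOver S f = sumF (λ i → if S i then f i else 0)

  ｛｝-refl : ∀ {n} (a : Fin n) → ｛ a ｝ a ≡ true
  ｛｝-refl a = dec-true (a F.≟ a) refl

  ｛｝-≢ : ∀ {n} {i a : Fin n} → i ≢ a → ｛ a ｝ i ≡ false
  ｛｝-≢ {i = i} {a} = dec-false (i F.≟ a)

  sumF-cong : ∀ {n} {f g : Fin n → ℕ} → (∀ i → f i ≡ g i) → sumF f ≡ sumF g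
  sumF-cong {zero}  f≗g = refl
  sumF-cong {suc n} f≗g = cong₂ _+_ (f≗g F.zero) (sumF-cong (λ i → f≗g (F.suc i)))

  sumF-mono-≤ : ∀ {n} {f g : Fin n → ℕ} → (∀ i → f i ≤ g i) → sumF f ≤ sumF g
  sumF-mono-≤ {zero}  f≤g = z≤n
  sumF-mono-≤ {suc n} f≤g = +-mono-≤ (f≤g F.zero) (sumF-mono-≤ (λ i → f≤g (F.suc i)))

  sumF-zero : ∀ n → sumF {n} (λ _ → 0) ≡ 0
  sumF-zero zero    = refl
  sumF-zero (suc n) = sumF-zero n

  sumF-distrib-+ : ∀ {n} (f g : Fin n → ℕ) → sumF (λ i → f i + g i) ≡ sumF f + sumF g
  sumF-distrib-+ {zero}  f g = refl
  sumF-distrib-+ {suc n} f g =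
    trans (cong (f F.zero + g F.zero +_) (sumF-distrib-+ (λ i → f (F.suc i)) (λ i → g (F.suc i))))
          (interchange (f F.zero) (g F.zero) _ _)
    where open import Algebra.Properties.CommutativeSemigroup +-commutativeSemigroup using (interchange)

  sumF²-distrib-+ : ∀ {m n} (f g : Fin m → Fin n → ℕ) →
    sumF (λ i → sumF λ j → f i j + g i j) ≡ sumF (λ i → sumF (f i)) + sumF (λ i → sumF (g i))
  sumF²-distrib-+ f g =
    trans (sumF-cong λ i → sumF-distrib-+ (f i) (g i)) (sumF-distrib-+ (λ i → sumF (f i)) (λ i → sumF (g i)))

  sumF-comm : ∀ {m n} (f : Fin m → Fin n → ℕ) →
              sumF (λ i → sumF (f i)) ≡ sumF (λ j → sumF (λ i → f i j))
  sumF-comm {zero}  {n} f = sym (sumF-zero n)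
  sumF-comm {suc m} {n} f = begin
    sumF (f F.zero) + sumF (λ i → sumF (f (F.suc i)))
      ≡⟨ cong (sumF (f F.zero) +_) (sumF-comm (λ i → f (F.suc i))) ⟩
    sumF (f F.zero) + sumF (λ j → sumF (λ i → f (F.suc i) j))
      ≡⟨ sumF-distrib-+ (f F.zero) _ ⟨
    sumF (λ j → f F.zero j + sumF (λ i → f (F.suc i) j)) ∎
    where open ≡-Reasoning

  sumF-*ʳ : ∀ {n} (f : Fin n → ℕ) k → sumF (λ i → f i * k) ≡ sumF f * k
  sumF-*ʳ {zero}  f k = refl
  sumF-*ʳ {suc n} f k = trans (cong (f F.zero * k +_) (sumF-*ʳ (λ i → f (F.suc i)) k))
                              (sym (*-distribʳ-+ k (f F.zero) _))

  sumF-point : ∀ {n} (f : Fin n → ℕ) a → (∀ i → i ≢ a → f i ≡ 0) → sumF f ≡ f a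
  sumF-point {suc n} f F.zero f≡0 = begin
    f F.zero + sumF (λ i → f (F.suc i)) ≡⟨ cong (f F.zero +_) (sumF-cong (λ i → f≡0 (F.suc i) λ ())) ⟩
    f F.zero + sumF {n} (λ _ → 0)       ≡⟨ cong (f F.zero +_) (sumF-zero n) ⟩
    f F.zero + 0                        ≡⟨ +-identityʳ _ ⟩
    f F.zero                            ∎
    where open ≡-Reasoning
  sumF-point {suc n} f (F.suc a) f≡0 =
    trans (cong (_+ sumF (λ i → f (F.suc i))) (f≡0 F.zero λ ()))
          (sumF-point (λ i → f (F.suc i)) a (λ i i≢a → f≡0 (F.suc i) (i≢a ∘ F.suc-injective)))

  sumF≥1⇒∃ : ∀ {n} (f : Fin n → ℕ) → 1 ≤ sumF f → ∃ λ i → 1 ≤ f i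
  sumF≥1⇒∃ {suc n} f Σ≥1 with f F.zero in f₀
  ... | suc _ = F.zero , subst (1 ≤_) (sym f₀) (s≤s z≤n)
  ... | zero with sumF≥1⇒∃ (λ i → f (F.suc i)) Σ≥1
  ...   | i , fi≥1 = F.suc i , fi≥1

  sumF²-｛｝×｛｝ : ∀ {n} (a b : Fin n) → sumF (λ u → sumF λ v → 𝟙 (｛ a ｝ u ∧ ｛ b ｝ v)) ≡ 1
  sumF²-｛｝×｛｝ {n} a b = begin
    sumF (λ u → sumF λ v → 𝟙 (｛ a ｝ u ∧ ｛ b ｝ v))  ≡⟨ sumF-point _ a vanish ⟩
    sumF (λ v → 𝟙 (｛ a ｝ a ∧ ｛ b ｝ v))
      ≡⟨ cong (λ x → sumF (λ v → 𝟙 (x ∧ ｛ b ｝ v))) (｛｝-refl a) ⟩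
    sumF (λ v → 𝟙 (｛ b ｝ v))  ≡⟨ sumF-point _ b (λ v v≢b → cong 𝟙 (｛｝-≢ v≢b)) ⟩
    𝟙 (｛ b ｝ b)               ≡⟨ cong 𝟙 (｛｝-refl b) ⟩
    1                          ∎
    where
    open ≡-Reasoning
    vanish : ∀ u → u ≢ a → sumF (λ v → 𝟙 (｛ a ｝ u ∧ ｛ b ｝ v)) ≡ 0
    vanish u u≢a rewrite ｛｝-≢ u≢a = sumF-zero n

  count≡sumF𝟙 : ∀ {n} (p : Subset n) → count p ≡ sumF (λ i → 𝟙 (p i))
  count≡sumF𝟙 {zero}  p = refl
  count≡sumF𝟙 {suc n} p with p F.zero
  ... | true  = cong suc (count≡sumF𝟙 (λ i → p (F.suc i)))
  ... | false = count≡sumF𝟙 (λ i → p (F.suc i))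

  count-⊤ : ∀ n → count {n} ⊤ₛ ≡ n
  count-⊤ zero    = refl
  count-⊤ (suc n) = cong suc (count-⊤ n)

  count-split : ∀ {n} (S X : Subset n) → count S ≡ count (S ∩ X) + count (S ∩ ∁ X)
  count-split S X = begin
    count S                                       ≡⟨ count≡sumF𝟙 S ⟩
    sumF (λ i → 𝟙 (S i))                          ≡⟨ sumF-cong (λ i → 𝟙-split′ (S i) (X i)) ⟩
    sumF (λ i → 𝟙 ((S ∩ X) i) + 𝟙 ((S ∩ ∁ X) i))
      ≡⟨ sumF-distrib-+ (λ i → 𝟙 ((S ∩ X) i)) (λ i → 𝟙 ((S ∩ ∁ X) i)) ⟩
    sumF (λ i → 𝟙 ((S ∩ X) i)) + sumF (λ i → 𝟙 ((S ∩ ∁ X) i))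
      ≡⟨ cong₂ _+_ (count≡sumF𝟙 (S ∩ X)) (count≡sumF𝟙 (S ∩ ∁ X)) ⟨
    count (S ∩ X) + count (S ∩ ∁ X)               ∎
    where
    open ≡-Reasoning
    𝟙-split′ : ∀ s x → 𝟙 s ≡ 𝟙 (s ∧ x) + 𝟙 (s ∧ not x)
    𝟙-split′ false x     = refl
    𝟙-split′ true  true  = refl
    𝟙-split′ true  false = refl

  count-∁ : ∀ {n} (X : Subset n) → count X + count (∁ X) ≡ n
  count-∁ {n} X = trans (sym (count-split ⊤ₛ X)) (count-⊤ n)

  count-≤ : ∀ {n} (X : Subset n) → count X ≤ n
  count-≤ X = subst (count X ≤_) (count-∁ X) (m≤m+n _ _)

  count-∩-｛｝ : ∀ {n} (S : Subset n) a → S a ≡ true → count (S ∩ ｛ a ｝) ≡ 1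
  count-∩-｛｝ S a Sa = begin
    count (S ∩ ｛ a ｝)                ≡⟨ count≡sumF𝟙 (S ∩ ｛ a ｝) ⟩
    sumF (λ i → 𝟙 (S i ∧ ｛ a ｝ i))   ≡⟨ sumF-point _ a vanish ⟩
    𝟙 (S a ∧ ｛ a ｝ a)                ≡⟨ cong₂ (λ s b → 𝟙 (s ∧ b)) Sa (｛｝-refl a) ⟩
    1                                 ∎
    where
    open ≡-Reasoning
    vanish : ∀ i → i ≢ a → 𝟙 (S i ∧ ｛ a ｝ i) ≡ 0
    vanish i i≢a rewrite ｛｝-≢ i≢a | ∧-zeroʳ (S i) = refl

  count-remove : ∀ {n} (S : Subset n) a → S a ≡ true → count S ≡ suc (count (S ∩ ∁ ｛ a ｝))
  count-remove S a Sa = trans (count-split S ｛ a ｝) (cong (_+ count (S ∩ ∁ ｛ a ｝)) (count-∩-｛｝ S a Sa))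

  ∈⇒count≥1 : ∀ {n} (S : Subset n) a → S a ≡ true → 1 ≤ count S
  ∈⇒count≥1 S a Sa = subst (1 ≤_) (sym (count-remove S a Sa)) (s≤s z≤n)

  count≥1⇒∈ : ∀ {n} (p : Subset n) → 1 ≤ count p → ∃ λ i → p i ≡ true
  count≥1⇒∈ {suc n} p |p|≥1 with p F.zero in p₀
  ... | true  = F.zero , p₀
  ... | false with count≥1⇒∈ (λ i → p (F.suc i)) |p|≥1
  ...   | i , pi = F.suc i , pi

  sumOver-≥ : ∀ {n} (S : Subset n) (f : Fin n → ℕ) c → (∀ i → S i ≡ true → c ≤ f i) →
              c * count S ≤ sumOver S f
  sumOver-≥ {zero}  S f c c≤f = ≤-reflexive (*-zeroʳ c)
  sumOver-≥ {suc n} S f c c≤f with S F.zero in S₀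
  ... | true  = ≤-trans (≤-reflexive (*-suc c _)) (+-mono-≤ (c≤f F.zero S₀) rest)
    where rest = sumOver-≥ (λ i → S (F.suc i)) (λ i → f (F.suc i)) c (λ i → c≤f (F.suc i))
  ... | false = sumOver-≥ (λ i → S (F.suc i)) (λ i → f (F.suc i)) c (λ i → c≤f (F.suc i))

  sumOver-*ʳ : ∀ {n} (S : Subset n) (f : Fin n → ℕ) k → sumOver S (λ i → f i * k) ≡ sumOver S f * k
  sumOver-*ʳ S f k = trans (sumF-cong pointwise) (sumF-*ʳ (λ i → if S i then f i else 0) k)
    where
    pointwise : ∀ i → (if S i then f i * k else 0) ≡ (if S i then f i else 0) * k
    pointwise i with S i
    ... | true  = refl
    ... | false = refl

  sumOver-∩-｛｝ : ∀ {n} (S : Subset n) (f : Fin n → ℕ) a → sumOver (S ∩ ｛ a ｝) f ≤ f a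
  sumOver-∩-｛｝ S f a = ≤-trans (≤-reflexive (sumF-point _ a vanish)) (at-a (S a) (｛ a ｝ a))
    where
    vanish : ∀ i → i ≢ a → (if S i ∧ ｛ a ｝ i then f i else 0) ≡ 0
    vanish i i≢a rewrite ｛｝-≢ i≢a | ∧-zeroʳ (S i) = refl
    at-a : ∀ s x → (if s ∧ x then f a else 0) ≤ f a
    at-a true  true  = ≤-refl
    at-a true  false = z≤n
    at-a false x     = z≤n

  exists-≤-average : ∀ {n} (S : Subset n) (f : Fin n → ℕ) → 1 ≤ count S →
                     ∃ λ i → S i ≡ true × f i * count S ≤ sumOver S f
  exists-≤-average S f |S|≥1 with F.any? (λ i → (S i ≟ᵇ true) ×-dec (f i * count S ≤? sumOver S f))
  ... | yes found = found
  ... | no  none  = contradiction (*-cancelʳ-≤ (suc total) total k ⦃ >-nonZero |S|≥1 ⦄ above-average) (n≮n total)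
    where
    open ≤-Reasoning
    k = count S
    total = sumOver S f
    above-average : suc total * k ≤ total * k
    above-average = begin
      suc total * k
        ≤⟨ sumOver-≥ S (λ i → f i * k) (suc total) (λ i Si → ≰⇒> (λ le → none (i , Si , le))) ⟩
      sumOver S (λ i → f i * k)  ≡⟨ sumOver-*ʳ S f k ⟩
      total * k                  ∎

  nC2*2≡n*pred[n] : ∀ n → (n C 2) * 2 ≡ n * pred n
  nC2*2≡n*pred[n] zero    = refl
  nC2*2≡n*pred[n] (suc n) = begin
    (suc n C 2) * 2            ≡⟨ cong (_* 2) (nCk+nC[k+1]≡[n+1]C[k+1] n 1) ⟨
    (n C 1 + n C 2) * 2        ≡⟨ *-distribʳ-+ 2 (n C 1) (n C 2) ⟩
    (n C 1) * 2 + (n C 2) * 2  ≡⟨ cong₂ (λ a b → a * 2 + b) (nC1≡n n) (nC2*2≡n*pred[n] n) ⟩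
    n * 2 + n * pred n         ≡⟨ *-distribˡ-+ n 2 (pred n) ⟨
    n * (2 + pred n)           ≡⟨ closing n ⟩
    suc n * n                  ∎
    where
    open ≡-Reasoning
    closing : ∀ n → n * (2 + pred n) ≡ suc n * n
    closing zero    = refl
    closing (suc n) = *-comm (suc n) (2 + n)

  -- Deleting a vertex of at most average degree d from a (2 + m)-set does not lower the density
  -- arcs/(k(k − 1)): a and b are the arc counts before and after the deletion.
  density-step : ∀ {a b d P Q} m .{{_ : NonZero m}} → a ≤ b + 2 * d → d * (2 + m) ≤ a →
                 b * P ≤ Q * (suc m * m) → a * P ≤ Q * ((2 + m) * suc m)
  density-step {a} {b} {d} {P} {Q} m a≤b+2d avg b-dense = *-cancelʳ-≤ (a * P) _ m (begin
    a * P * m                 ≡⟨ solve 3 (λ a P m → a :* P :* m := a :* m :* P) refl a P m ⟩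
    a * m * P                 ≤⟨ *-monoˡ-≤ P a*m≤b*[2+m] ⟩
    b * (2 + m) * P           ≡⟨ solve 3 (λ b P m → b :* (con 2 :+ m) :* P := b :* P :* (con 2 :+ m)) refl b P m ⟩
    b * P * (2 + m)           ≤⟨ *-monoˡ-≤ (2 + m) b-dense ⟩
    Q * (suc m * m) * (2 + m) ≡⟨ solve 2 (λ Q m → Q :* ((con 1 :+ m) :* m) :* (con 2 :+ m)
                                             := Q :* ((con 2 :+ m) :* (con 1 :+ m)) :* m) refl Q m ⟩
    Q * ((2 + m) * suc m) * m ∎)
    where
    open ≤-Reasoning
    open +-*-Solver
    a*m≤b*[2+m] : a * m ≤ b * (2 + m)
    a*m≤b*[2+m] = +-cancelʳ-≤ (2 * a) (a * m) (b * (2 + m)) (begin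
      a * m + 2 * a                    ≡⟨ solve 2 (λ a m → a :* m :+ con 2 :* a := a :* (con 2 :+ m)) refl a m ⟩
      a * (2 + m)                      ≤⟨ *-monoˡ-≤ (2 + m) a≤b+2d ⟩
      (b + 2 * d) * (2 + m)            ≡⟨ solve 3 (λ b d m → (b :+ con 2 :* d) :* (con 2 :+ m)
                                             := b :* (con 2 :+ m) :+ con 2 :* (d :* (con 2 :+ m))) refl b d m ⟩
      b * (2 + m) + 2 * (d * (2 + m))  ≤⟨ +-monoʳ-≤ (b * (2 + m)) (*-monoʳ-≤ 2 avg) ⟩
      b * (2 + m) + 2 * a              ∎)

module Degrees {n : ℕ} (G : Graph n) where
  open import Data.Nat
  open import Data.Nat.Properties
  open import Data.Nat.Solver using (module +-*-Solver)
  open import Data.Bool.Properties using (∧-comm; ∨-comm)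
  open import Data.Sum using (inj₁; inj₂)
  open Counting

  -- arcs S S = 2e(G[S]), and arcs S T = e(S, T) for disjoint S and T.
  arcs : Subset n → Subset n → ℕ
  arcs S T = sumF λ u → sumF λ v → 𝟙 (S u ∧ T v ∧ adj G u v)

  arcs-sym : ∀ S T → arcs S T ≡ arcs T S
  arcs-sym S T = trans (sumF-comm λ u v → 𝟙 (S u ∧ T v ∧ adj G u v))
                       (sumF-cong λ v → sumF-cong λ u → cong 𝟙 (∧-exchange (S u) (T v) (Graph.sym G u v)))

  arcs-splitˡ : ∀ X S T → arcs S T ≡ arcs (S ∩ X) T + arcs (S ∩ ∁ X) T
  arcs-splitˡ X S T = trans (sumF-cong λ u → sumF-cong λ v → 𝟙-split (S u) (X u) (T v ∧ adj G u v))
                            (sumF²-distrib-+ (λ u v → 𝟙 ((S ∩ X) u ∧ T v ∧ adj G u v))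
                                             (λ u v → 𝟙 ((S ∩ ∁ X) u ∧ T v ∧ adj G u v)))

  arcs-splitʳ : ∀ X S T → arcs S T ≡ arcs S (T ∩ X) + arcs S (T ∩ ∁ X)
  arcs-splitʳ X S T = begin
    arcs S T                           ≡⟨ arcs-sym S T ⟩
    arcs T S                           ≡⟨ arcs-splitˡ X T S ⟩
    arcs (T ∩ X) S + arcs (T ∩ ∁ X) S  ≡⟨ cong₂ _+_ (arcs-sym (T ∩ X) S) (arcs-sym (T ∩ ∁ X) S) ⟩
    arcs S (T ∩ X) + arcs S (T ∩ ∁ X)  ∎
    where open ≡-Reasoning

  arcs-sumOver : ∀ S T → arcs S T ≡ sumOver S (λ u → count (λ v → T v ∧ adj G u v))
  arcs-sumOver S T = sumF-cong pointwise
    where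
    pointwise : ∀ u → sumF (λ v → 𝟙 (S u ∧ T v ∧ adj G u v)) ≡
                      (if S u then count (λ v → T v ∧ adj G u v) else 0)
    pointwise u with S u
    ... | true  = sym (count≡sumF𝟙 (λ v → T v ∧ adj G u v))
    ... | false = sumF-zero n

  sumF-deg≡arcs : sumF (deg G) ≡ arcs ⊤ₛ ⊤ₛ
  sumF-deg≡arcs = sym (arcs-sumOver ⊤ₛ ⊤ₛ)

  degreeSum-cut : ∀ X → sumF (deg G) + arcs (∁ X) (∁ X) ≡ arcs X X + 2 * sumOver (∁ X) (deg G)
  degreeSum-cut X = begin
    sumF (deg G) + c
      ≡⟨ cong (_+ c) (trans sumF-deg≡arcs (arcs-splitˡ X ⊤ₛ ⊤ₛ)) ⟩
    (arcs X ⊤ₛ + arcs (∁ X) ⊤ₛ) + c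
      ≡⟨ cong (λ e → (e + arcs (∁ X) ⊤ₛ) + c) (arcs-splitʳ X X ⊤ₛ) ⟩
    ((a + arcs X (∁ X)) + arcs (∁ X) ⊤ₛ) + c
      ≡⟨ cong (λ e → ((a + e) + arcs (∁ X) ⊤ₛ) + c) (arcs-sym X (∁ X)) ⟩
    ((a + b) + arcs (∁ X) ⊤ₛ) + c
      ≡⟨ cong (λ e → ((a + b) + e) + c) Y-out ⟩
    ((a + b) + (b + c)) + c
      ≡⟨ solve 3 (λ a b c → ((a :+ b) :+ (b :+ c)) :+ c := a :+ con 2 :* (b :+ c)) refl a b c ⟩
    a + 2 * (b + c)
      ≡⟨ cong (λ e → a + 2 * e) (trans (sym Y-out) (arcs-sumOver (∁ X) ⊤ₛ)) ⟩
    a + 2 * sumOver (∁ X) (deg G)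
      ∎
    where
    open ≡-Reasoning
    open +-*-Solver
    a = arcs X X
    b = arcs (∁ X) X
    c = arcs (∁ X) (∁ X)
    Y-out : arcs (∁ X) ⊤ₛ ≡ b + c
    Y-out = arcs-splitʳ X (∁ X) ⊤ₛ

  arcs-∩-｛｝ : ∀ S T u → arcs (S ∩ ｛ u ｝) T ≤ degInduced G T u
  arcs-∩-｛｝ S T u = ≤-trans (≤-reflexive (arcs-sumOver (S ∩ ｛ u ｝) T)) (sumOver-∩-｛｝ S _ u)

  arcs-remove : ∀ S u → arcs S S ≤ arcs (S ∩ ∁ ｛ u ｝) (S ∩ ∁ ｛ u ｝) + 2 * degInduced G S u
  arcs-remove S u = begin
    arcs S S                          ≡⟨ arcs-splitˡ ｛ u ｝ S S ⟩
    arcs P S + arcs R S               ≡⟨ cong (arcs P S +_) (arcs-splitʳ ｛ u ｝ R S) ⟩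
    arcs P S + (arcs R P + arcs R R)  ≤⟨ +-monoˡ-≤ _ (arcs-∩-｛｝ S S u) ⟩
    d + (arcs R P + arcs R R)         ≤⟨ +-monoʳ-≤ d (+-monoˡ-≤ (arcs R R) R→P≤d) ⟩
    d + (d + arcs R R)                ≡⟨ solve 2 (λ d r → d :+ (d :+ r) := r :+ con 2 :* d) refl d (arcs R R) ⟩
    arcs R R + 2 * d                  ∎
    where
    open ≤-Reasoning
    open +-*-Solver
    P = S ∩ ｛ u ｝
    R = S ∩ ∁ ｛ u ｝
    d = degInduced G S u
    R→P≤d : arcs R P ≤ d
    R→P≤d = begin
      arcs R P             ≤⟨ m≤n+m _ _ ⟩
      arcs P P + arcs R P  ≡⟨ arcs-splitˡ ｛ u ｝ S P ⟨
      arcs S P             ≡⟨ arcs-sym S P ⟩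
      arcs P S             ≤⟨ arcs-∩-｛｝ S S u ⟩
      d                    ∎

  exists-edge : 1 ≤ sumF (deg G) → ∃ λ a → ∃ λ b → adj G a b ≡ true
  exists-edge Σ≥1 with sumF≥1⇒∃ (deg G) Σ≥1
  ... | a , deg≥1 = a , count≥1⇒∈ (adj G a) deg≥1

  handshake-≤ : (H : Subgraph G) → sumF (degSub H) ≤ 2 * numEdgesSub H
  handshake-≤ H = begin
    sumF (degSub H)                         ≡⟨ sumF-cong (λ u → count≡sumF𝟙 (edge H u)) ⟩
    sumF (λ u → sumF λ v → 𝟙 (edge H u v))  ≤⟨ sumF-mono-≤ (λ u → sumF-mono-≤ (λ v → split u v)) ⟩
    sumF (λ u → sumF λ v → L u v + L v u)   ≡⟨ sumF²-distrib-+ L (λ u v → L v u) ⟩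
    E + sumF (λ u → sumF λ v → L v u)       ≡⟨ cong (E +_) (sumF-comm L) ⟨
    E + E                                   ≡⟨ cong (E +_) (+-identityʳ E) ⟨
    2 * E                                   ≡⟨ cong (2 *_) E≡numEdges ⟩
    2 * numEdgesSub H                       ∎
    where
    open ≤-Reasoning
    open import Data.Fin using (toℕ)
    open import Data.Fin.Properties using (toℕ-injective)
    open import Data.Bool.Properties using (T-≡)
    open import Function.Bundles using (Equivalence)
    open import Relation.Binary.Definitions using (tri<; tri≈; tri>)
    L : Fin n → Fin n → ℕ
    L u v = 𝟙 ((toℕ u <ᵇ toℕ v) ∧ edge H u v)
    E = sumF (λ u → sumF (L u))
    E≡numEdges : E ≡ numEdgesSub H
    E≡numEdges = sumF-cong (λ u → sym (count≡sumF𝟙 (λ v → (toℕ u <ᵇ toℕ v) ∧ edge H u v)))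
    <ᵇ-true : ∀ {i j} → i < j → (i <ᵇ j) ≡ true
    <ᵇ-true i<j = Equivalence.to T-≡ (<⇒<ᵇ i<j)
    no-loop : ∀ u → edge H u u ≡ false
    no-loop u with edge H u u in loop
    ... | true  = contradiction (trans (sym (edge-sub H u u loop)) (irrefl G u)) λ ()
    ... | false = refl
    split : ∀ u v → 𝟙 (edge H u v) ≤ L u v + L v u
    split u v with <-cmp (toℕ u) (toℕ v)
    ... | tri< u<v _ _ rewrite <ᵇ-true u<v = m≤m+n _ _
    ... | tri> _ _ v<u rewrite <ᵇ-true v<u | edge-sym H v u = m≤n+m _ _
    ... | tri≈ _ u≡v _ rewrite toℕ-injective u≡v | no-loop v = z≤n

  induced : Subset n → Subgraph G
  induced S = record
    { vert     = S
    ; edge     = λ u v → S u ∧ S v ∧ adj G u v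
    ; edge-sym = λ u v → ∧-exchange (S u) (S v) (Graph.sym G u v)
    ; edge-sub = λ u v → ∧-true⇒ʳ (S v) ∘ ∧-true⇒ʳ (S u)
    ; edge-end = λ u v → ∧-true⇒ˡ (S u)
    }

  induced-proper : ∀ {S a} → S a ≡ false → Proper (induced S)
  induced-proper {S} {a} Sa≡false (all-in , _) = contradiction (trans (sym Sa≡false) (all-in a)) λ ()

  arcs≡sumF-degSub-induced : ∀ S → arcs S S ≡ sumF (degSub (induced S))
  arcs≡sumF-degSub-induced S = sumF-cong (λ u → sym (count≡sumF𝟙 (λ v → S u ∧ S v ∧ adj G u v)))

  avgDegSub-induced : ∀ S → avgDegSub (induced S) ≡ divQ (ℕ→ℚ (arcs S S)) (ℕ→ℚ (count S))
  avgDegSub-induced S =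
    cong (λ m → divQ (ℕ→ℚ m) (ℕ→ℚ (count S))) (trans (sumF-cong pointwise) (sym (arcs-sumOver S S)))
    where
    pointwise : ∀ u → (if S u then degSub (induced S) u else 0) ≡ (if S u then degInduced G S u else 0)
    pointwise u with S u
    ... | true  = refl
    ... | false = refl

  module _ {a b : Fin n} (a~b : adj G a b ≡ true) where
    isAB : Fin n → Fin n → Bool
    isAB u v = ｛ a ｝ u ∧ ｛ b ｝ v ∨ ｛ b ｝ u ∧ ｛ a ｝ v

    removeEdge : Subgraph G
    removeEdge = record
      { vert     = ⊤ₛ
      ; edge     = λ u v → adj G u v ∧ not (isAB u v)
      ; edge-sym = λ u v → cong₂ (λ x y → x ∧ not y) (Graph.sym G u v) (isAB-sym u v)
      ; edge-sub = λ u v → ∧-true⇒ˡ (adj G u v)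
      ; edge-end = λ _ _ _ → refl
      }
      where
      isAB-sym : ∀ u v → isAB u v ≡ isAB v u
      isAB-sym u v = trans (∨-comm (｛ a ｝ u ∧ ｛ b ｝ v) _)
                           (cong₂ _∨_ (∧-comm (｛ b ｝ u) _) (∧-comm (｛ a ｝ u) _))

    removeEdge-proper : Proper removeEdge
    removeEdge-proper (_ , same-edges) = contradiction (trans (same-edges a b) a~b) a≁b
      where
      a≁b : adj G a b ∧ not (isAB a b) ≢ true
      a≁b rewrite ｛｝-refl a | ｛｝-refl b | a~b = λ ()

    degreeSum-removeEdge : sumF (deg G) ≤ sumF (degSub removeEdge) + 2
    degreeSum-removeEdge = begin
      sumF (deg G)                            ≡⟨ sumF-cong (λ u → count≡sumF𝟙 (adj G u)) ⟩
      sumF (λ u → sumF λ v → 𝟙 (adj G u v))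
        ≤⟨ sumF-mono-≤ (λ u → sumF-mono-≤ (λ v → 𝟙-∧-not (adj G u v) (isAB u v))) ⟩
      sumF (λ u → sumF λ v → 𝟙 (adj G u v ∧ not (isAB u v)) + 𝟙 (isAB u v))
        ≡⟨ sumF²-distrib-+ (λ u v → 𝟙 (adj G u v ∧ not (isAB u v))) (λ u v → 𝟙 (isAB u v)) ⟩
      sumF (λ u → sumF λ v → 𝟙 (adj G u v ∧ not (isAB u v))) + ab-pairs
        ≡⟨ cong (_+ ab-pairs) (sumF-cong (λ u → count≡sumF𝟙 (edge removeEdge u))) ⟨
      sumF (degSub removeEdge) + ab-pairs     ≤⟨ +-monoʳ-≤ (sumF (degSub removeEdge)) ab-pairs≤2 ⟩
      sumF (degSub removeEdge) + 2            ∎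
      where
      open ≤-Reasoning
      ab-pairs = sumF (λ u → sumF λ v → 𝟙 (isAB u v))
      ab-pairs≤2 : ab-pairs ≤ 2
      ab-pairs≤2 = begin
        ab-pairs
          ≤⟨ sumF-mono-≤ (λ u → sumF-mono-≤ (λ v → 𝟙-∨ (｛ a ｝ u ∧ ｛ b ｝ v) _)) ⟩
        sumF (λ u → sumF λ v → 𝟙 (｛ a ｝ u ∧ ｛ b ｝ v) + 𝟙 (｛ b ｝ u ∧ ｛ a ｝ v))
          ≡⟨ sumF²-distrib-+ (λ u v → 𝟙 (｛ a ｝ u ∧ ｛ b ｝ v)) (λ u v → 𝟙 (｛ b ｝ u ∧ ｛ a ｝ v)) ⟩
        sumF (λ u → sumF λ v → 𝟙 (｛ a ｝ u ∧ ｛ b ｝ v)) +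
        sumF (λ u → sumF λ v → 𝟙 (｛ b ｝ u ∧ ｛ a ｝ v))
          ≡⟨ cong₂ _+_ (sumF²-｛｝×｛｝ a b) (sumF²-｛｝×｛｝ b a) ⟩
        2 ∎

  exists-dense-subset : ∀ {t} k (S : Subset n) → count S ≡ k → t ≤ k →
    ∃ λ T → count T ≡ t × arcs S S * (t * pred t) ≤ arcs T T * (k * pred k)
  exists-dense-subset k S |S|≡k t≤k with m≤n⇒m<n∨m≡n t≤k
  ... | inj₂ refl = S , |S|≡k , ≤-refl
  exists-dense-subset {t} (suc k) S |S|≡1+k _ | inj₁ (s≤s t≤k)
    with exists-≤-average S (degInduced G S) (subst (1 ≤_) (sym |S|≡1+k) (s≤s z≤n))
  ... | u , u∈S , low-degree
    with exists-dense-subset k (S ∩ ∁ ｛ u ｝) (suc-injective (trans (sym (count-remove S u u∈S)) |S|≡1+k)) t≤k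
  ... | T , |T|≡t , T-dense =
    T , |T|≡t , step k t≤k (subst₂ (λ c s → d * c ≤ s) |S|≡1+k (sym (arcs-sumOver S S)) low-degree) T-dense
    where
    d = degInduced G S u
    R = S ∩ ∁ ｛ u ｝
    step : ∀ k → t ≤ k → d * suc k ≤ arcs S S → arcs R R * (t * pred t) ≤ arcs T T * (k * pred k) →
           arcs S S * (t * pred t) ≤ arcs T T * (suc k * k)
    step 0 z≤n       _ _ rewrite *-zeroʳ (arcs S S) = z≤n
    step 1 z≤n       _ _ rewrite *-zeroʳ (arcs S S) = z≤n
    step 1 (s≤s z≤n) _ _ rewrite *-zeroʳ (arcs S S) = z≤n
    step (suc (suc j)) _ avg R-dense =
      density-step {arcs S S} {arcs R R} {d} {Q = arcs T T} (suc j) (arcs-remove S u) avg R-dense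

  exists-dense-t-subset : ∀ {t} → 1 ≤ t → t ≤ n → t * n ≤ sumF (deg G) →
    ∃ λ T → count T ≡ t × t * (t C 2) ≤ numEdgesSub (induced T) * pred n
  exists-dense-t-subset {t} t≥1 t≤n tn≤Σ with exists-dense-subset n ⊤ₛ (count-⊤ n) t≤n
  ... | T , |T|≡t , T-dense = T , |T|≡t ,
    *-cancelʳ-≤ _ _ 2 (*-cancelʳ-≤ _ _ n {{>-nonZero (≤-trans t≥1 t≤n)}} (begin
      t * (t C 2) * 2 * n
        ≡⟨ solve 3 (λ t c n → t :* c :* con 2 :* n := t :* n :* (c :* con 2)) refl t (t C 2) n ⟩
      t * n * ((t C 2) * 2)        ≡⟨ cong (t * n *_) (nC2*2≡n*pred[n] t) ⟩
      t * n * (t * pred t)         ≤⟨ *-monoˡ-≤ (t * pred t) tn≤Σ ⟩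
      sumF (deg G) * (t * pred t)  ≡⟨ cong (_* (t * pred t)) sumF-deg≡arcs ⟩
      arcs ⊤ₛ ⊤ₛ * (t * pred t)    ≤⟨ T-dense ⟩
      arcs T T * (n * pred n)      ≤⟨ *-monoˡ-≤ (n * pred n) T-edges ⟩
      2 * E * (n * pred n)
        ≡⟨ solve 3 (λ E n p → con 2 :* E :* (n :* p) := E :* p :* con 2 :* n) refl E n (pred n) ⟩
      E * pred n * 2 * n           ∎))
    where
    open ≤-Reasoning
    open +-*-Solver
    E = numEdgesSub (induced T)
    T-edges : arcs T T ≤ 2 * E
    T-edges = ≤-trans (≤-reflexive (arcs≡sumF-degSub-induced T)) (handshake-≤ (induced T))

  Y-degreeSum-bound : ∀ {t} X → sumF (deg G) ≤ t * n + 2 → arcs (∁ X) (∁ X) ≤ t * count (∁ X) →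
    t * count X ≤ arcs X X * 2 → 4 * sumOver (∁ X) (deg G) ≤ t * count X + 4 * t * count (∁ X) + 4
  Y-degreeSum-bound {t} X Σ≤tn+2 Y-sparse X-dense = +-cancelʳ-≤ (t * x) _ _ (begin
    4 * ΣY + t * x                 ≤⟨ +-monoʳ-≤ (4 * ΣY) X-dense ⟩
    4 * ΣY + arcs X X * 2
      ≡⟨ solve 2 (λ s a → con 4 :* s :+ a :* con 2 := con 2 :* (a :+ con 2 :* s)) refl ΣY (arcs X X) ⟩
    2 * (arcs X X + 2 * ΣY)        ≡⟨ cong (2 *_) (degreeSum-cut X) ⟨
    2 * (sumF (deg G) + arcs Y Y)  ≤⟨ *-monoʳ-≤ 2 (+-mono-≤ Σ≤tn+2 Y-sparse) ⟩
    2 * (t * n + 2 + t * y)        ≡⟨ cong (λ k → 2 * (t * k + 2 + t * y)) (count-∁ X) ⟨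
    2 * (t * (x + y) + 2 + t * y)  ≡⟨ solve 3 (λ t x y → con 2 :* (t :* (x :+ y) :+ con 2 :+ t :* y)
                                          := t :* x :+ con 4 :* t :* y :+ con 4 :+ t :* x) refl t x y ⟩
    t * x + 4 * t * y + 4 + t * x  ∎)
    where
    open ≤-Reasoning
    open +-*-Solver
    Y = ∁ X
    x = count X
    y = count Y
    ΣY = sumOver Y (deg G)

open Counting

open import Data.Integer as ℤ using (+_)
import Data.Integer.Properties as ℤ
import Data.Nat.Coprimality as Coprime
open import Data.Rational
  using (ℚ; _+_; _-_; -_; _*_; _<_; _≤_; 1ℚ; 0ℚ; ½; mkℚ; *≤*; *<*; positive; nonNegative; ≢-nonZero)
open import Data.Rational.Properties
open import Data.Rational.Solver using (module +-*-Solver)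
open +-*-Solver

ℕ→ℚ≡mkℚ : ∀ a → ℕ→ℚ a ≡ mkℚ (+ a) 0 (Coprime.sym (Coprime.1-coprimeTo a))
ℕ→ℚ≡mkℚ a = normalize-coprime (Coprime.sym (Coprime.1-coprimeTo a))

ℕ→ℚ-mono-≤ : ∀ {a b} → a ℕ.≤ b → ℕ→ℚ a ≤ ℕ→ℚ b
ℕ→ℚ-mono-≤ {a} {b} a≤b rewrite ℕ→ℚ≡mkℚ a | ℕ→ℚ≡mkℚ b =
  *≤* (ℤ.*-monoʳ-≤-nonNeg (+ 1) (ℤ.+≤+ a≤b))

ℕ→ℚ-cancel-≤ : ∀ {a b} → ℕ→ℚ a ≤ ℕ→ℚ b → a ℕ.≤ b
ℕ→ℚ-cancel-≤ {a} {b} a≤b rewrite ℕ→ℚ≡mkℚ a | ℕ→ℚ≡mkℚ b with a≤b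
... | *≤* a*1≤b*1 = ℤ.drop‿+≤+ (subst₂ ℤ._≤_ (ℤ.*-identityʳ (+ a)) (ℤ.*-identityʳ (+ b)) a*1≤b*1)

ℕ→ℚ-mono-< : ∀ {a b} → a ℕ.< b → ℕ→ℚ a < ℕ→ℚ b
ℕ→ℚ-mono-< {a} {b} a<b rewrite ℕ→ℚ≡mkℚ a | ℕ→ℚ≡mkℚ b =
  *<* (subst₂ ℤ._<_ (sym (ℤ.*-identityʳ (+ a))) (sym (ℤ.*-identityʳ (+ b))) (ℤ.+<+ a<b))

ℕ→ℚ-cancel-< : ∀ {a b} → ℕ→ℚ a < ℕ→ℚ b → a ℕ.< b
ℕ→ℚ-cancel-< {a} {b} a<b rewrite ℕ→ℚ≡mkℚ a | ℕ→ℚ≡mkℚ b with a<b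
... | *<* a*1<b*1 = ℤ.drop‿+<+ (subst₂ ℤ._<_ (ℤ.*-identityʳ (+ a)) (ℤ.*-identityʳ (+ b)) a*1<b*1)

ℕ→ℚ-homo-+ : ∀ a b → ℕ→ℚ (a ℕ.+ b) ≡ ℕ→ℚ a + ℕ→ℚ b
ℕ→ℚ-homo-+ a b = sym (trans (cong₂ _+_ (ℕ→ℚ≡mkℚ a) (ℕ→ℚ≡mkℚ b))
                            (/-cong (cong₂ ℤ._+_ (ℤ.*-identityʳ (+ a)) (ℤ.*-identityʳ (+ b))) refl))

ℕ→ℚ-homo-* : ∀ a b → ℕ→ℚ (a ℕ.* b) ≡ ℕ→ℚ a * ℕ→ℚ b
ℕ→ℚ-homo-* a b = sym (trans (cong₂ _*_ (ℕ→ℚ≡mkℚ a) (ℕ→ℚ≡mkℚ b))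
                            (/-cong {p₁ = + a ℤ.* + b} (ℤ.+◃n≡+n (a ℕ.* b)) refl))

ℕ→ℚ-nonNeg : ∀ a → 0ℚ ≤ ℕ→ℚ a
ℕ→ℚ-nonNeg a = ℕ→ℚ-mono-≤ {0} {a} z≤n

ℕ→ℚ-pos : ∀ {a} → 1 ℕ.≤ a → 0ℚ < ℕ→ℚ a
ℕ→ℚ-pos {a} = ℕ→ℚ-mono-< {0} {a}

p≤p+q : ∀ {p q} → 0ℚ ≤ q → p ≤ p + q
p≤p+q {p} {q} q≥0 = subst (_≤ p + q) (+-identityʳ p) (+-monoʳ-≤ p q≥0)

p≤q⇒0≤q-p : ∀ {p q} → p ≤ q → 0ℚ ≤ q - p
p≤q⇒0≤q-p {p} {q} p≤q = subst (_≤ q - p) (+-inverseʳ p) (+-monoˡ-≤ (- p) p≤q)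

p<q⇒0<q-p : ∀ {p q} → p < q → 0ℚ < q - p
p<q⇒0<q-p {p} {q} p<q = subst (_< q - p) (+-inverseʳ p) (+-monoˡ-< (- p) p<q)

+-nonNeg : ∀ {p q} → 0ℚ ≤ p → 0ℚ ≤ q → 0ℚ ≤ p + q
+-nonNeg {p} {q} p≥0 q≥0 = subst (_≤ p + q) (+-identityʳ 0ℚ) (+-mono-≤ p≥0 q≥0)

*-nonNeg : ∀ {p q} → 0ℚ ≤ p → 0ℚ ≤ q → 0ℚ ≤ p * q
*-nonNeg {p} {q} p≥0 q≥0 = subst (_≤ p * q) (*-zeroˡ q) (*-monoʳ-≤-nonNeg q {{nonNegative q≥0}} p≥0)

divQ-*-cancelʳ : ∀ p {q} → 0ℚ < q → divQ p q * q ≡ p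
divQ-*-cancelʳ p {q} q>0 with q ≟ 0ℚ
... | yes q≡0 = contradiction (sym q≡0) (<⇒≢ q>0)
... | no  q≢0 = trans (*-assoc p _ q) (trans (cong (p *_) (*-inverseˡ q {{≢-nonZero q≢0}})) (*-identityʳ p))

divQ-nonNeg : ∀ {p q} → 0ℚ ≤ p → 0ℚ < q → 0ℚ ≤ divQ p q
divQ-nonNeg {p} {q} p≥0 q>0 =
  *-cancelʳ-≤-pos q {{positive q>0}} (subst₂ _≤_ (sym (*-zeroˡ q)) (sym (divQ-*-cancelʳ p q>0)) p≥0)

≤-divQ⇒*≤ : ∀ {r p q} → 0ℚ < q → r ≤ divQ p q → r * q ≤ p
≤-divQ⇒*≤ {r} {p} {q} q>0 r≤p/q =
  subst (r * q ≤_) (divQ-*-cancelʳ p q>0) (*-monoʳ-≤-nonNeg q {{nonNegative (<⇒≤ q>0)}} r≤p/q)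

divQ-≤⇒≤* : ∀ {r p q} → 0ℚ < q → divQ p q ≤ r → p ≤ r * q
divQ-≤⇒≤* {r} {p} {q} q>0 p/q≤r =
  subst (_≤ r * q) (divQ-*-cancelʳ p q>0) (*-monoʳ-≤-nonNeg q {{nonNegative (<⇒≤ q>0)}} p/q≤r)

*≤*⇒divQ-*≤ : ∀ {p q c e} → 0ℚ < q → p * c ≤ e * q → divQ p q * c ≤ e
*≤*⇒divQ-*≤ {p} {q} {c} {e} q>0 pc≤eq = *-cancelʳ-≤-pos q {{positive q>0}} (begin
  divQ p q * c * q  ≡⟨ solve 3 (λ r c q → r :* c :* q := r :* q :* c) refl (divQ p q) c q ⟩
  divQ p q * q * c  ≡⟨ cong (_* c) (divQ-*-cancelʳ p q>0) ⟩
  p * c             ≤⟨ pc≤eq ⟩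
  e * q             ∎)
  where open ≤-Reasoning

≤-avg⇒*≤ : ∀ {t s k} → 1 ℕ.≤ k → ℕ→ℚ t ≤ divQ (ℕ→ℚ s) (ℕ→ℚ k) → t ℕ.* k ℕ.≤ s
≤-avg⇒*≤ {t} {s} {k} k≥1 t≤avg =
  ℕ→ℚ-cancel-≤ (subst (_≤ ℕ→ℚ s) (sym (ℕ→ℚ-homo-* t k)) (≤-divQ⇒*≤ (ℕ→ℚ-pos k≥1) t≤avg))

avg-≤⇒≤* : ∀ {t s k} → 1 ℕ.≤ k → divQ (ℕ→ℚ s) (ℕ→ℚ k) ≤ ℕ→ℚ t → s ℕ.≤ t ℕ.* k
avg-≤⇒≤* {t} {s} {k} k≥1 avg≤t =
  ℕ→ℚ-cancel-≤ (subst (ℕ→ℚ s ≤_) (sym (ℕ→ℚ-homo-* t k)) (divQ-≤⇒≤* (ℕ→ℚ-pos k≥1) avg≤t))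

sumOver-≥ℚ : ∀ {n} (S : Subset n) (f : Fin n → ℕ) {r} → 1 ℕ.≤ count S →
  (∀ i → S i ≡ true → r ≤ ℕ→ℚ (f i)) → ℕ→ℚ (count S) * r ≤ ℕ→ℚ (sumOver S f)
sumOver-≥ℚ S f {r} |S|≥1 r≤f with exists-≤-average S f |S|≥1
... | i , i∈S , below-average = begin
  ℕ→ℚ (count S) * r
    ≤⟨ *-monoˡ-≤-nonNeg (ℕ→ℚ (count S)) {{nonNegative (ℕ→ℚ-nonNeg (count S))}} (r≤f i i∈S) ⟩
  ℕ→ℚ (count S) * ℕ→ℚ (f i)
    ≡⟨ trans (*-comm (ℕ→ℚ (count S)) (ℕ→ℚ (f i))) (sym (ℕ→ℚ-homo-* (f i) (count S))) ⟩
  ℕ→ℚ (f i ℕ.* count S)      ≤⟨ ℕ→ℚ-mono-≤ below-average ⟩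
  ℕ→ℚ (sumOver S f)          ∎
  where open ≤-Reasoning

¾ : ℚ
¾ = divQ (ℕ→ℚ 3) (ℕ→ℚ 4)

-- Read with A = λt − t − 3, m = |X| − 1 and y = |V ∖ X|: A(n − 1) ≤ t(λ − 3/4)|X|. The gap is
-- A + 2 + 3m + 2y plus a quarter of the slack in the hypothesis.
core-inequality : ∀ L T m y → 0ℚ ≤ m → 0ℚ ≤ y → 0ℚ < L * T - T - ℕ→ℚ 3 →
  ℕ→ℚ 4 * (y * (L * T - 1ℚ)) ≤ T * (1ℚ + m) + ℕ→ℚ 4 * T * y + ℕ→ℚ 4 →
  (L * T - T - ℕ→ℚ 3) * (m + y) ≤ T * ((L - ¾) * (1ℚ + m))
core-inequality L T m y m≥0 y≥0 A>0 hyp = subst (A * (m + y) ≤_) (sym identity) (p≤p+q gap≥0)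
  where
  A = L * T - T - ℕ→ℚ 3
  ¼ = divQ 1ℚ (ℕ→ℚ 4)
  slack = (T * (1ℚ + m) + ℕ→ℚ 4 * T * y + ℕ→ℚ 4) - ℕ→ℚ 4 * (y * (L * T - 1ℚ))
  identity : T * ((L - ¾) * (1ℚ + m)) ≡
             A * (m + y) + (¼ * slack + (A + (ℕ→ℚ 2 + (ℕ→ℚ 3 * m + ℕ→ℚ 2 * y))))
  identity = solve 4 (λ L T m y →
    let A = L :* T :- T :- con (ℕ→ℚ 3)
        slack = (T :* (con 1ℚ :+ m) :+ con (ℕ→ℚ 4) :* T :* y :+ con (ℕ→ℚ 4))
                :- con (ℕ→ℚ 4) :* (y :* (L :* T :- con 1ℚ))
    in T :* ((L :- con ¾) :* (con 1ℚ :+ m)) :=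
       A :* (m :+ y) :+ (con ¼ :* slack :+ (A :+ (con (ℕ→ℚ 2) :+ (con (ℕ→ℚ 3) :* m :+ con (ℕ→ℚ 2) :* y)))))
    refl L T m y
  gap≥0 = +-nonNeg (*-nonNeg (nonNegative⁻¹ ¼) (p≤q⇒0≤q-p hyp))
            (+-nonNeg (<⇒≤ A>0) (+-nonNeg (ℕ→ℚ-nonNeg 2)
              (+-nonNeg (*-nonNeg (ℕ→ℚ-nonNeg 3) m≥0) (*-nonNeg (ℕ→ℚ-nonNeg 2) y≥0))))

module _ {L : ℚ} {t : ℕ} (t≥1 : 1 ℕ.≤ t) (λ>1+3/t : 1ℚ + divQ (ℕ→ℚ 3) (ℕ→ℚ t) < L) where
  private
    T = ℕ→ℚ t
    T>0 : 0ℚ < T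
    T>0 = ℕ→ℚ-pos t≥1

  t+3<λt : T + ℕ→ℚ 3 < L * T
  t+3<λt = subst (_< L * T) expand (*-monoˡ-<-pos T {{positive T>0}} λ>1+3/t)
    where
    expand : (1ℚ + divQ (ℕ→ℚ 3) T) * T ≡ T + ℕ→ℚ 3
    expand = trans (*-distribʳ-+ T 1ℚ (divQ (ℕ→ℚ 3) T))
                   (cong₂ _+_ (*-identityˡ T) (divQ-*-cancelʳ (ℕ→ℚ 3) T>0))

  t<λt-1 : T < L * T - 1ℚ
  t<λt-1 = subst (_< L * T - 1ℚ) (solve 1 (λ T → T :+ con 1ℚ :- con 1ℚ := T) refl T)
                 (+-monoˡ-< (- 1ℚ) (≤-<-trans (+-monoʳ-≤ T (ℕ→ℚ-mono-≤ {1} {3} (s≤s z≤n))) t+3<λt))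

  [λ-1-3/t]t≡λt-t-3 : (L - 1ℚ - divQ (ℕ→ℚ 3) T) * T ≡ L * T - T - ℕ→ℚ 3
  [λ-1-3/t]t≡λt-t-3 =
    trans (solve 3 (λ L τ T → (L :- con 1ℚ :- τ) :* T := L :* T :- T :- τ :* T) refl L (divQ (ℕ→ℚ 3) T) T)
          (cong (λ s → L * T - T - s) (divQ-*-cancelʳ (ℕ→ℚ 3) T>0))

  λt-t-3>0 : 0ℚ < L * T - T - ℕ→ℚ 3
  λt-t-3>0 = subst (0ℚ <_) (solve 3 (λ L T s → L :* T :- (T :+ s) := L :* T :- T :- s) refl L T (ℕ→ℚ 3))
                   (p<q⇒0<q-p t+3<λt)

  ¾<λ : ¾ < L
  ¾<λ = <-≤-trans ¾<1 (<⇒≤ (≤-<-trans (p≤p+q (divQ-nonNeg (ℕ→ℚ-nonNeg 3) T>0)) λ>1+3/t))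
    where
    ¾<1 : ¾ < 1ℚ
    ¾<1 = *<* (ℤ.+<+ (s≤s (s≤s (s≤s (s≤s z≤n)))))

  edge-density-bound : ∀ {x y s e c} → 1 ℕ.≤ x →
    ℕ→ℚ y * (L * T - 1ℚ) ≤ ℕ→ℚ s → 4 ℕ.* s ℕ.≤ t ℕ.* x ℕ.+ 4 ℕ.* t ℕ.* y ℕ.+ 4 →
    t ℕ.* c ℕ.≤ e ℕ.* pred (x ℕ.+ y) →
    divQ ((L - 1ℚ - divQ (ℕ→ℚ 3) T) * T) ((L - ¾) * ℕ→ℚ x) * ℕ→ℚ c ≤ ℕ→ℚ e
  edge-density-bound {suc x′} {y} {s} {e} {c} _ Y-lower Y-upper edges =
    *≤*⇒divQ-*≤ {A} {q} {K} {E} q>0 (*-cancelʳ-≤-pos T {{positive T>0}} (begin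
      A * K * T          ≡⟨ solve 3 (λ A K T → A :* K :* T := A :* (T :* K)) refl A K T ⟩
      A * (T * K)        ≤⟨ *-monoˡ-≤-nonNeg A {{nonNegative A≥0}} edgesℚ ⟩
      A * (E * (M + Y))  ≡⟨ solve 4 (λ A E M Y → A :* (E :* (M :+ Y)) := E :* (A :* (M :+ Y))) refl A E M Y ⟩
      E * (A * (M + Y))  ≤⟨ *-monoˡ-≤-nonNeg E {{nonNegative (ℕ→ℚ-nonNeg e)}} core ⟩
      E * (T * q)        ≡⟨ solve 3 (λ E T q → E :* (T :* q) := E :* q :* T) refl E T q ⟩
      E * q * T          ∎))
    where
    open ≤-Reasoning
    M = ℕ→ℚ x′
    Y = ℕ→ℚ y
    E = ℕ→ℚ e
    K = ℕ→ℚ c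
    A = (L - 1ℚ - divQ (ℕ→ℚ 3) T) * T
    q = (L - ¾) * ℕ→ℚ (suc x′)
    A≥0 : 0ℚ ≤ A
    A≥0 = subst (0ℚ ≤_) (sym [λ-1-3/t]t≡λt-t-3) (<⇒≤ λt-t-3>0)
    q>0 : 0ℚ < q
    q>0 = subst (_< q) (*-zeroˡ (ℕ→ℚ (suc x′)))
                (*-monoˡ-<-pos (ℕ→ℚ (suc x′)) {{positive (ℕ→ℚ-pos {suc x′} (s≤s z≤n))}}
                               (p<q⇒0<q-p ¾<λ))
    x≡1+M : ℕ→ℚ (suc x′) ≡ 1ℚ + M
    x≡1+M = ℕ→ℚ-homo-+ 1 x′
    edgesℚ : T * K ≤ E * (M + Y)
    edgesℚ = subst₂ _≤_ (ℕ→ℚ-homo-* t c)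
                        (trans (ℕ→ℚ-homo-* e (x′ ℕ.+ y)) (cong (E *_) (ℕ→ℚ-homo-+ x′ y)))
                        (ℕ→ℚ-mono-≤ edges)
    Y-bound : ℕ→ℚ 4 * (Y * (L * T - 1ℚ)) ≤ T * (1ℚ + M) + ℕ→ℚ 4 * T * Y + ℕ→ℚ 4
    Y-bound = begin
      ℕ→ℚ 4 * (Y * (L * T - 1ℚ))  ≤⟨ *-monoˡ-≤-nonNeg (ℕ→ℚ 4) Y-lower ⟩
      ℕ→ℚ 4 * ℕ→ℚ s               ≡⟨ ℕ→ℚ-homo-* 4 s ⟨
      ℕ→ℚ (4 ℕ.* s)               ≤⟨ ℕ→ℚ-mono-≤ Y-upper ⟩
      ℕ→ℚ (t ℕ.* suc x′ ℕ.+ 4 ℕ.* t ℕ.* y ℕ.+ 4)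
        ≡⟨ trans (ℕ→ℚ-homo-+ (t ℕ.* suc x′ ℕ.+ 4 ℕ.* t ℕ.* y) 4) (cong (_+ ℕ→ℚ 4)
             (trans (ℕ→ℚ-homo-+ (t ℕ.* suc x′) (4 ℕ.* t ℕ.* y))
                    (cong₂ _+_ (trans (ℕ→ℚ-homo-* t (suc x′)) (cong (T *_) x≡1+M))
                               (trans (ℕ→ℚ-homo-* (4 ℕ.* t) y) (cong (_* Y) (ℕ→ℚ-homo-* 4 t)))))) ⟩
      T * (1ℚ + M) + ℕ→ℚ 4 * T * Y + ℕ→ℚ 4 ∎
    core : A * (M + Y) ≤ T * q
    core = subst₂ (λ a x → a * (M + Y) ≤ T * ((L - ¾) * x)) (sym [λ-1-3/t]t≡λt-t-3) (sym x≡1+M)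
                  (core-inequality L T M Y (ℕ→ℚ-nonNeg x′) (ℕ→ℚ-nonNeg y) λt-t-3>0 Y-bound)

module _ {n : ℕ} (G : Graph n) where
  open Degrees G

  arcs-≥-minDegree : ∀ {t} X → (∀ u → X u ≡ true → ℕ→ℚ t * ½ ≤ ℕ→ℚ (degInduced G X u)) →
                     t ℕ.* count X ℕ.≤ arcs X X ℕ.* 2
  arcs-≥-minDegree {t} X δ≥t/2 =
    ℕ.≤-trans (sumOver-≥ X (λ u → degInduced G X u ℕ.* 2) t t≤2d)
              (ℕ.≤-reflexive (trans (sumOver-*ʳ X (degInduced G X) 2) (cong (ℕ._* 2) (sym (arcs-sumOver X X)))))
    where
    t≤2d : ∀ u → X u ≡ true → t ℕ.≤ degInduced G X u ℕ.* 2
    t≤2d u u∈X = ℕ→ℚ-cancel-≤ (subst₂ _≤_ (trans (*-assoc (ℕ→ℚ t) ½ (ℕ→ℚ 2)) (*-identityʳ (ℕ→ℚ t)))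
                                          (sym (ℕ→ℚ-homo-* (degInduced G X u) 2))
                                          (*-monoʳ-≤-nonNeg (ℕ→ℚ 2) (δ≥t/2 u u∈X)))

  module _ {t : ℕ} (sparse : ∀ (H : Subgraph G) → Proper H → numVert H ≥ 1 → avgDegSub H ≤ ℕ→ℚ t) where
    arcs-≤-sparse : ∀ {S a} → S a ≡ false → 1 ℕ.≤ count S → arcs S S ℕ.≤ t ℕ.* count S
    arcs-≤-sparse {S} Sa≡false |S|≥1 = avg-≤⇒≤* {t} {arcs S S} |S|≥1
      (subst (_≤ ℕ→ℚ t) (avgDegSub-induced S) (sparse (induced S) (induced-proper Sa≡false) |S|≥1))

    degreeSum-≤-sparse : 1 ℕ.≤ sumF (deg G) → sumF (deg G) ℕ.≤ t ℕ.* n ℕ.+ 2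
    degreeSum-≤-sparse Σ≥1 with exists-edge Σ≥1
    ... | a , b , a~b = ℕ.≤-trans (degreeSum-removeEdge a~b) (ℕ.+-monoˡ-≤ 2 G-e-sparse)
      where
      |V|≥1 = ∈⇒count≥1 ⊤ₛ a refl
      G-e-sparse : sumF (degSub (removeEdge a~b)) ℕ.≤ t ℕ.* n
      G-e-sparse = subst (λ k → sumF (degSub (removeEdge a~b)) ℕ.≤ t ℕ.* k) (count-⊤ n)
        (avg-≤⇒≤* {t} {sumF (degSub (removeEdge a~b))} {count (⊤ₛ {n})} |V|≥1
                  (sparse (removeEdge a~b) (removeEdge-proper a~b) |V|≥1))

lemma2p5 : (t c : ℕ) → t ≥ 1 → (λ' : ℚ) → 1ℚ + divQ (ℕ→ℚ 3) (ℕ→ℚ t) < λ' →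
    {n : ℕ} (G : Graph n) →
    ℕ→ℚ t ≤ avgDeg G →
    (∀ (H : Subgraph G) → Proper H → numVert H ≥ 1 → avgDegSub H ≤ ℕ→ℚ t) →
    (X : Fin n → Bool) →
    (∃ λ x → X x ≡ true) → (∃ λ y → X y ≡ false) →
    (∀ u → X u ≡ true → ℕ→ℚ t * ½ ≤ ℕ→ℚ (degInduced G X u)) →
    (∀ u → X u ≡ false → λ' * ℕ→ℚ t - 1ℚ < ℕ→ℚ (deg G u)) →
    Σ (Subgraph G) λ H → (numVert H ≡ t) ×
      (divQ ((λ' - 1ℚ - divQ (ℕ→ℚ 3) (ℕ→ℚ t)) * ℕ→ℚ t)
            ((λ' - divQ (ℕ→ℚ 3) (ℕ→ℚ 4)) * ℕ→ℚ (count X))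
        * ℕ→ℚ (t C 2)
        ≤ ℕ→ℚ (numEdgesSub H))
lemma2p5 t _ t≥1 λ' λ>1+3/t {n} G avg≥t sparse X (x , x∈X) (y , y∉X) δ[X]≥t/2 deg[Y]>λt-1 =
  induced T , |T|≡t ,
  edge-density-bound t≥1 λ>1+3/t {s = sumOver Y (deg G)} {e = numEdgesSub (induced T)}
    |X|≥1 Y-degrees≥ Y-degrees≤
    (subst (λ k → t ℕ.* (t C 2) ℕ.≤ numEdgesSub (induced T) ℕ.* pred k) (sym (count-∁ X)) T-dense)
  where
  open Degrees G
  Y = ∁ X
  |X|≥1 = ∈⇒count≥1 X x x∈X
  |Y|≥1 = ∈⇒count≥1 Y y (cong not y∉X)
  n≥1 = ℕ.≤-trans |X|≥1 (count-≤ X)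
  tn≤Σ : t ℕ.* n ℕ.≤ sumF (deg G)
  tn≤Σ = ≤-avg⇒*≤ {t} n≥1 avg≥t
  Y-degrees≤ : 4 ℕ.* sumOver Y (deg G) ℕ.≤ t ℕ.* count X ℕ.+ 4 ℕ.* t ℕ.* count Y ℕ.+ 4
  Y-degrees≤ = Y-degreeSum-bound {t} X
    (degreeSum-≤-sparse G {t} sparse (ℕ.≤-trans (ℕ.*-mono-≤ t≥1 n≥1) tn≤Σ))
    (arcs-≤-sparse G {t} sparse (cong not x∈X) |Y|≥1)
    (arcs-≥-minDegree G {t} X δ[X]≥t/2)
  Y-degrees≥ : ℕ→ℚ (count Y) * (λ' * ℕ→ℚ t - 1ℚ) ≤ ℕ→ℚ (sumOver Y (deg G))
  Y-degrees≥ = sumOver-≥ℚ Y (deg G) |Y|≥1 (λ u u∈Y → <⇒≤ (deg[Y]>λt-1 u (not-injective u∈Y)))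
  t≤n : t ℕ.≤ n
  t≤n = ℕ.≤-trans (ℕ.<⇒≤ (ℕ→ℚ-cancel-< (<-trans (t<λt-1 t≥1 λ>1+3/t) (deg[Y]>λt-1 y y∉X))))
                  (count-≤ (adj G y))
  dense = exists-dense-t-subset t≥1 t≤n tn≤Σ
  T = proj₁ dense
  |T|≡t = proj₁ (proj₂ dense)
  T-dense = proj₂ (proj₂ dense)
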